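{- Every even subdivision of a simply bad graph is simply bad.
   Context: An even subdivision of a graph $G$ is a graph obtained from $G$ by replacing each edge by a path of odd length (i.e., subdividing each edge an even number of times). For a graph $G$ with a $1$-factor $F$: a cycle $C$ is $F$-alternating if $|E(C)|=2|E(F)\cap E(C)|$; in an orientation of $G$ an even cycle $C$ is evenly (resp. oddly) oriented if, for either direction of traversal, the number of edges of $C$ directed along the traversal is even (resp. odd); a zero-sum $F$-set is a finite family $\{C_1,\ldots,C_k\}$ of $F$-alternating cycles such that every edge of $G$ lies in an even number of its members, and it is an odd $F$-set if $k$ is odd. A graph $G$ is simply bad if it has a $1$-factor $F$ such that $G$ has an odd $F$-set $\mathcal{A}$ and an orientation in which every member of $\mathcal{A}$ is evenly oriented. -}

module Defs where

open import Data.Nat using (ℕ; zero; suc; _+_; _*_; _<_; _≤_)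
open import Data.Fin using (Fin; zero; suc; toℕ; fromℕ; inject₁; _≟_)
open import Data.Bool using (Bool; true; false; if_then_else_; _∨_)
open import Data.Product using (Σ; Σ-syntax; ∃; _×_; _,_; proj₁; proj₂; swap)
open import Data.Sum using (_⊎_)
open import Data.List using (List; length)
open import Data.List.Relation.Unary.All using (All)
open import Relation.Nullary using (¬_)
open import Relation.Nullary.Decidable using (⌊_⌋)
open import Relation.Binary.PropositionalEquality using (_≡_; _≢_)

Even : ℕ → Set
Even n = Σ ℕ λ k → n ≡ 2 * k

Odd : ℕ → Set
Odd n = Σ ℕ λ k → n ≡ suc (2 * k)

countFin : (k : ℕ) → (Fin k → Bool) → ℕ
countFin zero    p = 0
countFin (suc k) p = (if p zero then 1 else 0) + countFin k (λ i → p (suc i))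

anyFin : (k : ℕ) → (Fin k → Bool) → Bool
anyFin zero    p = false
anyFin (suc k) p = p zero ∨ anyFin k (λ i → p (suc i))

countList : {A : Set} → (A → Bool) → List A → ℕ
countList p List.[] = 0
countList p (x List.∷ xs) = (if p x then 1 else 0) + countList p xs

record Graph : Set where
  field
    n        : ℕ
    m        : ℕ
    ends     : Fin m → Fin n × Fin n
    loopless : ∀ e → proj₁ (ends e) ≢ proj₂ (ends e)
    simple   : ∀ e f → (ends e ≡ ends f ⊎ ends e ≡ swap (ends f)) → e ≡ f

open Graph public

Vertex : Graph → Set
Vertex G = Fin (n G)

Edge : Graph → Set
Edge G = Fin (m G)

Joins : (G : Graph) → Edge G → Vertex G → Vertex G → Set
Joins G e u v = ends G e ≡ (u , v) ⊎ ends G e ≡ (v , u)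

incidentᵇ : (G : Graph) → Vertex G → Edge G → Bool
incidentᵇ G v e = ⌊ proj₁ (ends G e) ≟ v ⌋ ∨ ⌊ proj₂ (ends G e) ≟ v ⌋

EdgeSet : Graph → Set
EdgeSet G = Edge G → Bool

IsOneFactor : (G : Graph) → EdgeSet G → Set
IsOneFactor G F =
  ∀ v → countFin (m G) (λ e → if F e then incidentᵇ G v e else false) ≡ 1

-- The walk also fixes a direction of traversal.

record Cycle (G : Graph) : Set where
  field
    len      : ℕ
    len≥3    : 3 ≤ len
    vtx      : Fin (suc len) → Vertex G
    edg      : Fin len → Edge G
    closed   : vtx zero ≡ vtx (fromℕ len)
    distinct : ∀ i j → vtx (inject₁ i) ≡ vtx (inject₁ j) → i ≡ j
    links    : ∀ i → Joins G (edg i) (vtx (inject₁ i)) (vtx (suc i))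

open Cycle public

_∈Cᵇ_ : {G : Graph} → Edge G → Cycle G → Bool
e ∈Cᵇ C = anyFin (len C) (λ i → ⌊ edg C i ≟ e ⌋)

FAlternating : (G : Graph) → EdgeSet G → Cycle G → Set
FAlternating G F C = len C ≡ 2 * countFin (len C) (λ i → F (edg C i))

-- An orientation: o e = true directs e from proj₁ (ends e) to proj₂ (ends e),
-- o e = false directs it the other way.
Orientation : Graph → Set
Orientation G = Edge G → Bool

tail : (G : Graph) → Orientation G → Edge G → Vertex G
tail G o e = if o e then proj₁ (ends G e) else proj₂ (ends G e)

forwardCount : (G : Graph) → Orientation G → Cycle G → ℕ
forwardCount G o C = countFin (len C) (λ i → ⌊ tail G o (edg C i) ≟ vtx C (inject₁ i) ⌋)

-- C is evenly oriented (C even, so the parity does not depend on the direction)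
EvenlyOriented : (G : Graph) → Orientation G → Cycle G → Set
EvenlyOriented G o C = Even (forwardCount G o C)

ZeroSumFSet : (G : Graph) → EdgeSet G → List (Cycle G) → Set
ZeroSumFSet G F A = All (FAlternating G F) A × (∀ e → Even (countList (λ C → e ∈Cᵇ C) A))

OddFSet : (G : Graph) → EdgeSet G → List (Cycle G) → Set
OddFSet G F A = ZeroSumFSet G F A × Odd (length A)

SimplyBad : Graph → Set
SimplyBad G =
  Σ[ F ∈ EdgeSet G ] IsOneFactor G F ×
  (Σ[ A ∈ List (Cycle G) ] OddFSet G F A ×
   (Σ[ o ∈ Orientation G ] All (EvenlyOriented G o) A))

pathLen : ℕ → ℕ
pathLen h = suc (2 * h)

Internal : {L : ℕ} → Fin (suc L) → Set
Internal {L} i = 0 < toℕ i × toℕ i < L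

record EvenSubdivision (G H : Graph) : Set where
  field
    φ        : Vertex G → Vertex H
    φ-inj    : ∀ x y → φ x ≡ φ y → x ≡ y
    half     : Edge G → ℕ
    pv       : (e : Edge G) → Fin (suc (pathLen (half e))) → Vertex H
    pe       : (e : Edge G) → Fin (pathLen (half e)) → Edge H
    pv-start : ∀ e → pv e zero ≡ φ (proj₁ (ends G e))
    pv-end   : ∀ e → pv e (fromℕ (pathLen (half e))) ≡ φ (proj₂ (ends G e))
    pv-inj   : ∀ e i j → pv e i ≡ pv e j → i ≡ j
    pe-links : ∀ e i → Joins H (pe e i) (pv e (inject₁ i)) (pv e (suc i))
    int-notφ : ∀ e i x → Internal i → pv e i ≢ φ x
    int-disj : ∀ e f i j → Internal i → pv e i ≡ pv f j → e ≡ f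
    v-cover  : ∀ w → (Σ[ x ∈ Vertex G ] φ x ≡ w) ⊎
                     (Σ[ e ∈ Edge G ] Σ[ i ∈ Fin (suc (pathLen (half e))) ] pv e i ≡ w)
    e-cover  : ∀ h → Σ[ e ∈ Edge G ] Σ[ i ∈ Fin (pathLen (half e)) ] pe e i ≡ h
    e-unique : ∀ e f i j → pe e i ≡ pe f j → e ≡ f

-- Replace each edge e of G by a path of odd length 2 · half e + 1. A 1-factor F of G lifts to the
-- 1-factor F′ of H containing, along the path of e, the edges at even positions if e ∈ F and those at
-- odd positions otherwise; an orientation lifts by directing every edge of the path of e as e is directed.
-- A cycle C of G lifts to the cycle of H running through the paths of its edges: it has |C| + 2 Σ half
-- edges, of which |C ∩ F| + Σ half lie in F′, so F-alternating cycles lift to F′-alternating ones, and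
-- each edge of C directed along C yields 2 · half + 1 forward edges, so the parity of the forward count
-- is preserved. An edge of H on the path of e lies on the lift of C iff e ∈ C, so the lifts of a
-- zero-sum odd F-set form a zero-sum odd F′-set.

module Submission where

open import Data.Nat using (ℕ; zero; suc; _+_; _*_; _∸_; _<_; _≤_; _<?_; _≤?_; z≤n; s≤s; z<s)
open import Data.Nat.Properties hiding (_≟_)
open import Algebra.Properties.CommutativeSemigroup +-commutativeSemigroup using () renaming (interchange to +-interchange)
open import Data.Fin using (Fin; zero; suc; toℕ; fromℕ; fromℕ<; inject₁; _≟_)
open import Data.Fin.Properties using (toℕ-fromℕ<; fromℕ<-toℕ; toℕ<n; toℕ-injective; toℕ-inject₁; toℕ-fromℕ)
import Data.Fin.Properties as Fin
open import Data.Bool using (Bool; true; false; if_then_else_; not)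
open import Data.Bool.Properties using (∨-zeroʳ; not-injective)
open import Data.Product using (∃; _×_; _,_; proj₁; proj₂; swap)
open import Data.Product.Properties using (,-injective)
open import Data.Sum using (_⊎_; inj₁; inj₂)
open import Data.Empty using (⊥; ⊥-elim)
open import Data.List using ([]; _∷_; map)
open import Data.List.Properties using (length-map)
import Data.List.Relation.Unary.All as All
open import Data.List.Relation.Unary.All.Properties using (map⁺)
open import Function using (_∘_)
open import Relation.Nullary using (yes; no; contradiction)
open import Relation.Nullary.Decidable using (⌊_⌋; isYes≗does; dec-true; dec-false)
open import Relation.Binary.PropositionalEquality
open import Defs

∸-suc-< : ∀ {n j} → j < n → n ∸ suc j < n
∸-suc-< j<n = ∸-monoʳ-< z<s j<n

suc-∸-suc : ∀ {n j} → j < n → suc (n ∸ suc j) ≡ n ∸ j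
suc-∸-suc {n} {j} j<n = sym (+-∸-assoc 1 j<n)

data Position (n a : ℕ) : Set where
  start : a ≡ 0 → Position n a
  end   : a ≡ n → Position n a
  inner : 0 < a → a < n → Position n a

position : ∀ {n a} → a ≤ n → Position n a
position {a = zero}  _     = start refl
position {a = suc a} 1+a≤n with m≤n⇒m<n∨m≡n 1+a≤n
... | inj₁ 1+a<n = inner z<s 1+a<n
... | inj₂ 1+a≡n = end 1+a≡n

iverson : Bool → ℕ
iverson b = if b then 1 else 0

sumTo : ℕ → (ℕ → ℕ) → ℕ
sumTo zero    g = 0
sumTo (suc k) g = g 0 + sumTo k (g ∘ suc)

countTo : ℕ → (ℕ → Bool) → ℕ
countTo k p = sumTo k (iverson ∘ p)

sumTo-cong : ∀ k {g h : ℕ → ℕ} → (∀ n → n < k → g n ≡ h n) → sumTo k g ≡ sumTo k h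
sumTo-cong zero    eq = refl
sumTo-cong (suc k) eq = cong₂ _+_ (eq 0 (s≤s z≤n)) (sumTo-cong k (λ n n<k → eq (suc n) (s≤s n<k)))

sumTo-+ : ∀ k (g h : ℕ → ℕ) → sumTo k (λ n → g n + h n) ≡ sumTo k g + sumTo k h
sumTo-+ zero    g h = refl
sumTo-+ (suc k) g h = trans (cong (g 0 + h 0 +_) (sumTo-+ k (g ∘ suc) (h ∘ suc))) (+-interchange (g 0) (h 0) _ _)

sumTo-*ˡ : ∀ k c (g : ℕ → ℕ) → sumTo k (λ n → c * g n) ≡ c * sumTo k g
sumTo-*ˡ zero    c g = sym (*-zeroʳ c)
sumTo-*ˡ (suc k) c g = trans (cong (c * g 0 +_) (sumTo-*ˡ k c (g ∘ suc))) (sym (*-distribˡ-+ c (g 0) _))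

sumTo-const : ∀ k x → sumTo k (λ _ → x) ≡ k * x
sumTo-const zero    x = refl
sumTo-const (suc k) x = cong (x +_) (sumTo-const k x)

sumTo-+-range : ∀ a b (g : ℕ → ℕ) → sumTo (a + b) g ≡ sumTo a g + sumTo b (λ n → g (a + n))
sumTo-+-range zero    b g = refl
sumTo-+-range (suc a) b g = trans (cong (g 0 +_) (sumTo-+-range a b (g ∘ suc))) (sym (+-assoc (g 0) _ _))

sumTo-suc-last : ∀ k (g : ℕ → ℕ) → sumTo (suc k) g ≡ sumTo k g + g k
sumTo-suc-last k g = begin
  sumTo (suc k) g              ≡⟨ cong (λ t → sumTo t g) (+-comm 1 k) ⟩
  sumTo (k + 1) g              ≡⟨ sumTo-+-range k 1 g ⟩
  sumTo k g + (g (k + 0) + 0)  ≡⟨ cong (sumTo k g +_) (trans (+-identityʳ _) (cong g (+-identityʳ k))) ⟩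
  sumTo k g + g k              ∎
  where open ≡-Reasoning

sumTo-reverse : ∀ k (g : ℕ → ℕ) → sumTo k (λ j → g (k ∸ suc j)) ≡ sumTo k g
sumTo-reverse zero    g = refl
sumTo-reverse (suc k) g = begin
  g k + sumTo k (λ j → g (k ∸ suc j)) ≡⟨ cong (g k +_) (sumTo-reverse k g) ⟩
  g k + sumTo k g                     ≡⟨ +-comm (g k) _ ⟩
  sumTo k g + g k                     ≡⟨ sumTo-suc-last k g ⟨
  sumTo (suc k) g                     ∎
  where open ≡-Reasoning

countFin-toℕ : ∀ k (p : ℕ → Bool) → countFin k (p ∘ toℕ) ≡ countTo k p
countFin-toℕ zero    p = refl
countFin-toℕ (suc k) p = cong (iverson (p 0) +_) (countFin-toℕ k (p ∘ suc))

countFin-cong : ∀ k {p q : Fin k → Bool} → (∀ i → p i ≡ q i) → countFin k p ≡ countFin k q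
countFin-cong zero    eq = refl
countFin-cong (suc k) eq = cong₂ _+_ (cong iverson (eq zero)) (countFin-cong k (eq ∘ suc))

countFin-head-true : ∀ k (p : Fin (suc k) → Bool) → p zero ≡ true → countFin (suc k) p ≡ suc (countFin k (p ∘ suc))
countFin-head-true k p eq rewrite eq = refl

countFin-head-false : ∀ k (p : Fin (suc k) → Bool) → p zero ≡ false → countFin (suc k) p ≡ countFin k (p ∘ suc)
countFin-head-false k p eq rewrite eq = refl

countFin≡0⇒false : ∀ k (p : Fin k → Bool) → countFin k p ≡ 0 → ∀ i → p i ≡ false
countFin≡0⇒false (suc k) p c i with p zero in eq
countFin≡0⇒false (suc k) p c zero    | false = eq
countFin≡0⇒false (suc k) p c (suc i) | false = countFin≡0⇒false k (p ∘ suc) c i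

false⇒countFin≡0 : ∀ k (p : Fin k → Bool) → (∀ i → p i ≡ false) → countFin k p ≡ 0
false⇒countFin≡0 zero    p f = refl
false⇒countFin≡0 (suc k) p f = trans (countFin-head-false k p (f zero)) (false⇒countFin≡0 k (p ∘ suc) (f ∘ suc))

countFin≡1⇒∃ : ∀ k (p : Fin k → Bool) → countFin k p ≡ 1 → ∃ λ i → p i ≡ true
countFin≡1⇒∃ (suc k) p c with p zero in eq
... | true  = zero , eq
... | false = let i , pi = countFin≡1⇒∃ k (p ∘ suc) c in suc i , pi

countFin≡1⇒tail-false : ∀ k (p : Fin (suc k) → Bool) → countFin (suc k) p ≡ 1 → p zero ≡ true → ∀ i → p (suc i) ≡ false
countFin≡1⇒tail-false k p c p₀ = countFin≡0⇒false k (p ∘ suc) (suc-injective (trans (sym (countFin-head-true k p p₀)) c))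

countFin≡1⇒unique : ∀ k (p : Fin k → Bool) → countFin k p ≡ 1 →
                    ∀ i j → p i ≡ true → p j ≡ true → i ≡ j
countFin≡1⇒unique (suc k) p c zero    zero    _  _  = refl
countFin≡1⇒unique (suc k) p c zero    (suc j) p₀ pj = contradiction (trans (sym pj) (countFin≡1⇒tail-false k p c p₀ j)) λ ()
countFin≡1⇒unique (suc k) p c (suc i) zero    pi p₀ = contradiction (trans (sym pi) (countFin≡1⇒tail-false k p c p₀ i)) λ ()
countFin≡1⇒unique (suc k) p c (suc i) (suc j) pi pj with p zero in eq
... | true  = contradiction (trans (sym pi) (countFin≡0⇒false k (p ∘ suc) (suc-injective c) i)) λ ()
... | false = cong suc (countFin≡1⇒unique k (p ∘ suc) c i j pi pj)

unique⇒countFin≡1 : ∀ k (p : Fin k → Bool) i → p i ≡ true → (∀ j → p j ≡ true → j ≡ i) → countFin k p ≡ 1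
unique⇒countFin≡1 (suc k) p zero    pi u = trans (countFin-head-true k p pi) (cong suc (false⇒countFin≡0 k (p ∘ suc) others))
  where
  others : ∀ j → p (suc j) ≡ false
  others j with p (suc j) in eq
  ... | false = refl
  ... | true  = contradiction (u (suc j) eq) λ ()
unique⇒countFin≡1 (suc k) p (suc i) pi u with p zero in eq
... | true  = contradiction (u zero eq) λ ()
... | false = unique⇒countFin≡1 k (p ∘ suc) i pi (λ j pj → Fin.suc-injective (u (suc j) pj))

anyFin≡true⇒∃ : ∀ k (p : Fin k → Bool) → anyFin k p ≡ true → ∃ λ i → p i ≡ true
anyFin≡true⇒∃ (suc k) p a with p zero in eq
... | true  = zero , eq
... | false = let i , pi = anyFin≡true⇒∃ k (p ∘ suc) a in suc i , pi

∃⇒anyFin≡true : ∀ k (p : Fin k → Bool) i → p i ≡ true → anyFin k p ≡ true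
∃⇒anyFin≡true (suc k) p zero    pi rewrite pi = refl
∃⇒anyFin≡true (suc k) p (suc i) pi with p zero
... | true  = refl
... | false = ∃⇒anyFin≡true k (p ∘ suc) i pi

≡true⇔⇒≡ : ∀ {a b : Bool} → (a ≡ true → b ≡ true) → (b ≡ true → a ≡ true) → a ≡ b
≡true⇔⇒≡ {true}  {true}  f g = refl
≡true⇔⇒≡ {true}  {false} f g = sym (f refl)
≡true⇔⇒≡ {false} {true}  f g = g refl
≡true⇔⇒≡ {false} {false} f g = refl

⌊≟⌋≡true⇒≡ : ∀ {k} {a b : Fin k} → ⌊ a ≟ b ⌋ ≡ true → a ≡ b
⌊≟⌋≡true⇒≡ {a = a} {b} t with a ≟ b
... | yes a≡b = a≡b

≡⇒⌊≟⌋≡true : ∀ {k} {a b : Fin k} → a ≡ b → ⌊ a ≟ b ⌋ ≡ true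
≡⇒⌊≟⌋≡true {a = a} {b} a≡b = trans (isYes≗does (a ≟ b)) (dec-true (a ≟ b) a≡b)

≢⇒⌊≟⌋≡false : ∀ {k} {a b : Fin k} → a ≢ b → ⌊ a ≟ b ⌋ ≡ false
≢⇒⌊≟⌋≡false {a = a} {b} a≢b = trans (isYes≗does (a ≟ b)) (dec-false (a ≟ b) a≢b)

if-≟-then : ∀ {k} {x y : Fin k} → x ≢ y → ∀ c → ⌊ (if c then x else y) ≟ x ⌋ ≡ c
if-≟-then x≢y true  = ≡⇒⌊≟⌋≡true refl
if-≟-then x≢y false = ≢⇒⌊≟⌋≡false (x≢y ∘ sym)

if-≟-else : ∀ {k} {x y : Fin k} → x ≢ y → ∀ c → ⌊ (if c then x else y) ≟ y ⌋ ≡ not c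
if-≟-else x≢y true  = ≢⇒⌊≟⌋≡false x≢y
if-≟-else x≢y false = ≡⇒⌊≟⌋≡true refl

evenᵇ : ℕ → Bool
evenᵇ zero          = true
evenᵇ (suc zero)    = false
evenᵇ (suc (suc n)) = evenᵇ n

evenᵇ-suc : ∀ n → evenᵇ (suc n) ≡ not (evenᵇ n)
evenᵇ-suc zero          = refl
evenᵇ-suc (suc zero)    = refl
evenᵇ-suc (suc (suc n)) = evenᵇ-suc n

evenᵇ-2* : ∀ h → evenᵇ (2 * h) ≡ true
evenᵇ-2* zero    = refl
evenᵇ-2* (suc h) rewrite +-suc h (h + 0) = evenᵇ-2* h

-- Reads a Fin-indexed family at a natural number; out of range it returns the junk value d.
at : ∀ {A : Set} {k} → (Fin k → A) → A → ℕ → A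
at {k = k} f d n with n <? k
... | yes n<k = f (fromℕ< n<k)
... | no  _   = d

at-fromℕ< : ∀ {A : Set} {k} (f : Fin k → A) d {n} (n<k : n < k) → at f d n ≡ f (fromℕ< n<k)
at-fromℕ< {k = k} f d {n} n<k with n <? k
... | yes n<k′ = cong f (Fin.fromℕ<-cong n n refl n<k′ n<k)
... | no  n≮k  = contradiction n<k n≮k

at-toℕ : ∀ {A : Set} {k} (f : Fin k → A) d (i : Fin k) → at f d (toℕ i) ≡ f i
at-toℕ f d i = trans (at-fromℕ< f d (toℕ<n i)) (cong f (fromℕ<-toℕ i (toℕ<n i)))

module _ (K : Graph) where

  Incident : Edge K → Vertex K → Set
  Incident e v = proj₁ (ends K e) ≡ v ⊎ proj₂ (ends K e) ≡ v

  incidentᵇ⇒Incident : ∀ {v e} → incidentᵇ K v e ≡ true → Incident e v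
  incidentᵇ⇒Incident {v} {e} t with proj₁ (ends K e) ≟ v | proj₂ (ends K e) ≟ v
  ... | yes p | _     = inj₁ p
  ... | no _  | yes q = inj₂ q

  Incident⇒incidentᵇ : ∀ {v e} → Incident e v → incidentᵇ K v e ≡ true
  Incident⇒incidentᵇ (inj₁ p) rewrite ≡⇒⌊≟⌋≡true p = refl
  Incident⇒incidentᵇ {v} {e} (inj₂ q) rewrite ≡⇒⌊≟⌋≡true q = ∨-zeroʳ ⌊ proj₁ (ends K e) ≟ v ⌋

  Joins⇒≢ : ∀ {e a b} → Joins K e a b → a ≢ b
  Joins⇒≢ {e} (inj₁ x) a≡b = loopless K e (trans (cong proj₁ x) (trans a≡b (sym (cong proj₂ x))))
  Joins⇒≢ {e} (inj₂ x) a≡b = loopless K e (trans (cong proj₁ x) (trans (sym a≡b) (sym (cong proj₂ x))))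

  Joins-sym : ∀ {e a b} → Joins K e a b → Joins K e b a
  Joins-sym (inj₁ x) = inj₂ x
  Joins-sym (inj₂ x) = inj₁ x

  Joins⇒Incidentˡ : ∀ {e a b} → Joins K e a b → Incident e a
  Joins⇒Incidentˡ (inj₁ x) = inj₁ (cong proj₁ x)
  Joins⇒Incidentˡ (inj₂ x) = inj₂ (cong proj₂ x)

  Joins⇒Incidentʳ : ∀ {e a b} → Joins K e a b → Incident e b
  Joins⇒Incidentʳ = Joins⇒Incidentˡ ∘ Joins-sym

  Joins-Incident : ∀ {e a b v} → Joins K e a b → Incident e v → a ≡ v ⊎ b ≡ v
  Joins-Incident (inj₁ x) (inj₁ y) = inj₁ (trans (sym (cong proj₁ x)) y)
  Joins-Incident (inj₁ x) (inj₂ y) = inj₂ (trans (sym (cong proj₂ x)) y)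
  Joins-Incident (inj₂ x) (inj₁ y) = inj₂ (trans (sym (cong proj₁ x)) y)
  Joins-Incident (inj₂ x) (inj₂ y) = inj₁ (trans (sym (cong proj₂ x)) y)

  Joins-unique : ∀ {e a b c d} → Joins K e a b → Joins K e c d → (a ≡ c × b ≡ d) ⊎ (a ≡ d × b ≡ c)
  Joins-unique (inj₁ x) (inj₁ y) = inj₁ (,-injective (trans (sym x) y))
  Joins-unique (inj₁ x) (inj₂ y) = inj₂ (,-injective (trans (sym x) y))
  Joins-unique (inj₂ x) (inj₁ y) = inj₂ (swap (,-injective (trans (sym x) y)))
  Joins-unique (inj₂ x) (inj₂ y) = inj₁ (swap (,-injective (trans (sym x) y)))

  oriented : Bool → Edge K → Vertex K × Vertex K
  oriented true  e = ends K e
  oriented false e = swap (ends K e)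

  Joins⇒oriented : ∀ {e u v} → Joins K e u v → oriented ⌊ proj₁ (ends K e) ≟ u ⌋ e ≡ (u , v)
  Joins⇒oriented {e} {u} j with proj₁ (ends K e) ≟ u | j
  ... | yes _ | inj₁ x = x
  ... | no  p | inj₁ x = contradiction (cong proj₁ x) p
  ... | yes p | inj₂ x = contradiction (trans (sym (cong proj₁ x)) p) (Joins⇒≢ (Joins-sym j))
  ... | no  _ | inj₂ x = cong swap x

  tail-≟-oriented : ∀ o e d → ⌊ tail K o e ≟ proj₁ (oriented d e) ⌋ ≡ (if d then o e else not (o e))
  tail-≟-oriented o e true  = if-≟-then (loopless K e) (o e)
  tail-≟-oriented o e false = if-≟-else (loopless K e) (o e)

  tail-≟ : ∀ o e {t} → Incident e t → o e ≡ ⌊ proj₁ (ends K e) ≟ t ⌋ → tail K o e ≡ t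
  tail-≟ o e {t} i oe with proj₁ (ends K e) ≟ t | i
  ... | yes p | _      rewrite oe = p
  ... | no  _ | inj₂ q rewrite oe = q
  ... | no ¬p | inj₁ p = contradiction p ¬p

  module _ {F : EdgeSet K} where

    private
      covers : Vertex K → Edge K → Bool
      covers v e = if F e then incidentᵇ K v e else false

      covers-true⇒ : ∀ {v e} → covers v e ≡ true → F e ≡ true × Incident e v
      covers-true⇒ {v} {e} t with F e
      ... | true = refl , incidentᵇ⇒Incident t

      ⇒covers-true : ∀ {v e} → F e ≡ true → Incident e v → covers v e ≡ true
      ⇒covers-true Fe i rewrite Fe = Incident⇒incidentᵇ i

    IsOneFactor⇒∃ : IsOneFactor K F → ∀ v → ∃ λ e → F e ≡ true × Incident e v
    IsOneFactor⇒∃ isF v = let e , t = countFin≡1⇒∃ (m K) (covers v) (isF v) in e , covers-true⇒ t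

    IsOneFactor⇒unique : IsOneFactor K F → ∀ {v e e′} →
                         F e ≡ true → Incident e v → F e′ ≡ true → Incident e′ v → e ≡ e′
    IsOneFactor⇒unique isF {v} Fe i Fe′ i′ =
      countFin≡1⇒unique (m K) (covers v) (isF v) _ _ (⇒covers-true Fe i) (⇒covers-true Fe′ i′)

    ∃-unique⇒IsOneFactor : (∀ v → ∃ λ e → F e ≡ true × Incident e v) →
                           (∀ {v e e′} → F e ≡ true → Incident e v → F e′ ≡ true → Incident e′ v → e ≡ e′) →
                           IsOneFactor K F
    ∃-unique⇒IsOneFactor ex un v =
      let e , Fe , i = ex v in
      unique⇒countFin≡1 (m K) (covers v) e (⇒covers-true Fe i)
        (λ e′ t → let Fe′ , i′ = covers-true⇒ t in un Fe′ i′ Fe i)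

module CycleAt {G : Graph} (C : Cycle G) where

  k : ℕ
  k = len C

  0<k : 0 < k
  0<k = ≤-trans (s≤s z≤n) (len≥3 C)

  w : ℕ → Vertex G
  w = at (vtx C) (vtx C zero)

  c : ℕ → Edge G
  c = at (edg C) (edg C (fromℕ< 0<k))

  w-toℕ : ∀ (i : Fin k) → w (toℕ i) ≡ vtx C (inject₁ i)
  w-toℕ i = trans (cong w (sym (toℕ-inject₁ i))) (at-toℕ (vtx C) _ (inject₁ i))

  c-toℕ : ∀ (i : Fin k) → c (toℕ i) ≡ edg C i
  c-toℕ = at-toℕ (edg C) _

  w-injective : ∀ {a b} → a < k → b < k → w a ≡ w b → a ≡ b
  w-injective {a} {b} a<k b<k eq = begin
    a                     ≡⟨ toℕ-fromℕ< a<k ⟨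
    toℕ (fromℕ< a<k)      ≡⟨ cong toℕ (distinct C _ _ (begin
      vtx C (inject₁ (fromℕ< a<k)) ≡⟨ w-toℕ (fromℕ< a<k) ⟨
      w (toℕ (fromℕ< a<k))         ≡⟨ cong w (toℕ-fromℕ< a<k) ⟩
      w a                          ≡⟨ eq ⟩
      w b                          ≡⟨ cong w (toℕ-fromℕ< b<k) ⟨
      w (toℕ (fromℕ< b<k))         ≡⟨ w-toℕ (fromℕ< b<k) ⟩
      vtx C (inject₁ (fromℕ< b<k)) ∎)) ⟩
    toℕ (fromℕ< b<k)      ≡⟨ toℕ-fromℕ< b<k ⟩
    b                     ∎
    where open ≡-Reasoning

  w-k : w k ≡ w 0
  w-k = trans (cong w (sym (toℕ-fromℕ k))) (trans (at-toℕ (vtx C) _ (fromℕ k)) (sym (closed C)))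

  c-joins : ∀ {i} → i < k → Joins G (c i) (w i) (w (suc i))
  c-joins {i} i<k = subst (λ t → Joins G (c t) (w t) (w (suc t))) (toℕ-fromℕ< i<k) (joins (fromℕ< i<k))
    where
    joins : ∀ (x : Fin k) → Joins G (c (toℕ x)) (w (toℕ x)) (w (suc (toℕ x)))
    joins x rewrite c-toℕ x | w-toℕ x | at-toℕ (vtx C) (vtx C zero) (suc x) = links C x

  next : ℕ → ℕ
  next i with suc i <? k
  ... | yes _ = suc i
  ... | no  _ = 0

  next<k : ∀ i → next i < k
  next<k i with suc i <? k
  ... | yes 1+i<k = 1+i<k
  ... | no  _     = 0<k

  w-suc≡w-next : ∀ {i} → i < k → w (suc i) ≡ w (next i)
  w-suc≡w-next {i} i<k with suc i <? k
  ... | yes _    = refl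
  ... | no 1+i≮k = trans (cong w (≤-antisym i<k (≮⇒≥ 1+i≮k))) w-k

  -- This is where 3 ≤ len C is needed: a closed walk of length 2 would go back along its first edge.
  next∘next≢id : ∀ i → next (next i) ≢ i
  next∘next≢id i eq with suc i <? k
  next∘next≢id i eq | yes _ with suc (suc i) <? k
  ... | yes _    = >⇒≢ (m<n⇒m<1+n (n<1+n i)) eq
  ... | no 2+i≮k = 2+i≮k (subst (λ t → suc (suc t) < k) eq (len≥3 C))
  next∘next≢id i eq | no 1+i≮k with 1 <? k
  ... | yes _  = 1+i≮k (subst (λ t → suc t < k) eq (len≥3 C))
  ... | no 1≮k = 1≮k (≤-trans (n≤1+n 2) (len≥3 C))

  c-injective : ∀ {i i′} → i < k → i′ < k → c i ≡ c i′ → i ≡ i′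
  c-injective {i} {i′} i<k i′<k eq
    with Joins-unique G (c-joins i<k) (subst (λ e → Joins G e (w i′) (w (suc i′))) (sym eq) (c-joins i′<k))
  ... | inj₁ (wi≡wi′ , _) = w-injective i<k i′<k wi≡wi′
  ... | inj₂ (wi≡w1+i′ , w1+i≡wi′) = contradiction (trans (cong next (sym i≡next-i′)) next-i≡i′) (next∘next≢id i′)
    where
    i≡next-i′ : i ≡ next i′
    i≡next-i′ = w-injective i<k (next<k i′) (trans wi≡w1+i′ (w-suc≡w-next i′<k))
    next-i≡i′ : next i ≡ i′
    next-i≡i′ = w-injective (next<k i) i′<k (trans (sym (w-suc≡w-next i<k)) w1+i≡wi′)

module Blocks (ℓ : ℕ → ℕ) where

  offset : ℕ → ℕ
  offset zero    = 0
  offset (suc i) = offset i + ℓ i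

  offset-mono : ∀ {a b} → a ≤ b → offset a ≤ offset b
  offset-mono {b = zero}  z≤n = ≤-refl
  offset-mono {b = suc b} a≤1+b with m≤n⇒m<n∨m≡n a≤1+b
  ... | inj₂ refl          = ≤-refl
  ... | inj₁ (s≤s a≤b)     = ≤-trans (offset-mono a≤b) (m≤m+n _ _)

  offset≡sumTo : ∀ K → offset K ≡ sumTo K ℓ
  offset≡sumTo zero    = refl
  offset≡sumTo (suc K) = trans (cong (_+ ℓ K) (offset≡sumTo K)) (sym (sumTo-suc-last K ℓ))

  sumTo-offset : ∀ K (g : ℕ → ℕ) → sumTo (offset K) g ≡ sumTo K (λ i → sumTo (ℓ i) (λ j → g (offset i + j)))
  sumTo-offset zero    g = refl
  sumTo-offset (suc K) g = begin
    sumTo (offset K + ℓ K) g                                            ≡⟨ sumTo-+-range (offset K) (ℓ K) g ⟩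
    sumTo (offset K) g + sumTo (ℓ K) (λ j → g (offset K + j))           ≡⟨ cong (_+ sumTo (ℓ K) (λ j → g (offset K + j))) (sumTo-offset K g) ⟩
    sumTo K (λ i → sumTo (ℓ i) (λ j → g (offset i + j)))
      + sumTo (ℓ K) (λ j → g (offset K + j))                            ≡⟨ sumTo-suc-last K _ ⟨
    sumTo (suc K) (λ i → sumTo (ℓ i) (λ j → g (offset i + j)))          ∎
    where open ≡-Reasoning

  -- block K n is the index of the block containing position n, for n < offset K.
  block : ℕ → ℕ → ℕ
  block zero    n = 0
  block (suc K) n with offset K ≤? n
  ... | yes _ = K
  ... | no  _ = block K n

  block-offset+ : ∀ {K i j} → i < K → j < ℓ i → block K (offset i + j) ≡ i
  block-offset+ {suc K} {i} {j} i<1+K j<ℓi with offset K ≤? offset i + j | m≤n⇒m<n∨m≡n i<1+K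
  ... | yes _  | inj₂ refl      = refl
  ... | yes ≤n | inj₁ (s≤s i<K) = contradiction (≤-trans (offset-mono i<K) ≤n) (<⇒≱ (+-monoʳ-< (offset i) j<ℓi))
  ... | no  ≰n | inj₂ refl      = contradiction (m≤m+n (offset i) j) ≰n
  ... | no  _  | inj₁ (s≤s i<K) = block-offset+ i<K j<ℓi

  block-last : ∀ {K n} → offset K ≤ n → block (suc K) n ≡ K
  block-last {K} {n} ≤n with offset K ≤? n
  ... | yes _ = refl
  ... | no ≰n = contradiction ≤n ≰n

  split : ∀ K {n} → n < offset K → ∃ λ i → ∃ λ j → i < K × j < ℓ i × n ≡ offset i + j
  split (suc K) {n} n< with offset K ≤? n
  ... | yes ≤n = K , n ∸ offset K , ≤-refl , subst (n ∸ offset K <_) (m+n∸m≡n (offset K) (ℓ K)) (∸-monoˡ-< n< ≤n) , sym (m+[n∸m]≡n ≤n)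
  ... | no  ≰n = let i , j , i<K , rest = split K (≰⇒> ≰n) in i , j , m<n⇒m<1+n i<K , rest

  concat : ∀ {A : Set} → ℕ → (ℕ → ℕ → A) → ℕ → A
  concat K f n = f (block K n) (n ∸ offset (block K n))

  concat-offset+ : ∀ {A : Set} {K} (f : ℕ → ℕ → A) {i j} → i < K → j < ℓ i → concat K f (offset i + j) ≡ f i j
  concat-offset+ f {i} {j} i<K j<ℓi rewrite block-offset+ i<K j<ℓi = cong (f i) (m+n∸m≡n (offset i) j)

  -- The end of a block is read as the start of the next one, so the blocks must be glued.
  concat-offset-end : ∀ {A : Set} {K} (f : ℕ → ℕ → A) → (∀ i → 0 < ℓ i) →
                      (∀ {i} → suc i < K → f i (ℓ i) ≡ f (suc i) 0) →
                      ∀ {i} → i < K → concat K f (offset i + ℓ i) ≡ f i (ℓ i)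
  concat-offset-end {K = K} f ℓ-pos glue {i} i<K with suc i <? K
  ... | yes 1+i<K = begin
    concat K f (offset (suc i))        ≡⟨ cong (concat K f) (+-identityʳ (offset (suc i))) ⟨
    concat K f (offset (suc i) + 0)    ≡⟨ concat-offset+ f 1+i<K (ℓ-pos (suc i)) ⟩
    f (suc i) 0                        ≡⟨ glue 1+i<K ⟨
    f i (ℓ i)                          ∎
    where open ≡-Reasoning
  ... | no 1+i≮K with refl ← ≤-antisym i<K (≮⇒≥ 1+i≮K)
    rewrite block-last {i} {offset i + ℓ i} (m≤m+n (offset i) (ℓ i)) = cong (f i) (m+n∸m≡n (offset i) (ℓ i))

module Paths {G H : Graph} (S : EvenSubdivision G H) where
  open EvenSubdivision S public

  ℓ : Edge G → ℕ
  ℓ e = pathLen (half e)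

  0<ℓ : ∀ e → 0 < ℓ e
  0<ℓ e = s≤s z≤n

  pathV : Edge G → ℕ → Vertex H
  pathV e = at (pv e) (pv e zero)

  pathE : Edge G → ℕ → Edge H
  pathE e = at (pe e) (pe e zero)

  pathV-start : ∀ e → pathV e 0 ≡ φ (proj₁ (ends G e))
  pathV-start e = trans (at-toℕ (pv e) (pv e zero) zero) (pv-start e)

  pathV-end : ∀ e → pathV e (ℓ e) ≡ φ (proj₂ (ends G e))
  pathV-end e = trans (cong (pathV e) (sym (toℕ-fromℕ (ℓ e)))) (trans (at-toℕ (pv e) _ (fromℕ (ℓ e))) (pv-end e))

  pathV-injective : ∀ e {a b} → a ≤ ℓ e → b ≤ ℓ e → pathV e a ≡ pathV e b → a ≡ b
  pathV-injective e {a} {b} a≤ℓ b≤ℓ eq = begin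
    a                    ≡⟨ toℕ-fromℕ< (s≤s a≤ℓ) ⟨
    toℕ (fromℕ< (s≤s a≤ℓ)) ≡⟨ cong toℕ (pv-inj e _ _ (trans (sym (at-fromℕ< (pv e) _ (s≤s a≤ℓ)))
                                (trans eq (at-fromℕ< (pv e) _ (s≤s b≤ℓ))))) ⟩
    toℕ (fromℕ< (s≤s b≤ℓ)) ≡⟨ toℕ-fromℕ< (s≤s b≤ℓ) ⟩
    b                    ∎
    where open ≡-Reasoning

  pathE-joins : ∀ e {j} → j < ℓ e → Joins H (pathE e j) (pathV e j) (pathV e (suc j))
  pathE-joins e j<ℓ = subst (λ t → Joins H (pathE e t) (pathV e t) (pathV e (suc t))) (toℕ-fromℕ< j<ℓ) (joins (fromℕ< j<ℓ))
    where
    joins : ∀ i → Joins H (pathE e (toℕ i)) (pathV e (toℕ i)) (pathV e (suc (toℕ i)))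
    joins i rewrite at-toℕ (pe e) (pe e zero) i | at-toℕ (pv e) (pv e zero) (suc i)
              | sym (toℕ-inject₁ i) | at-toℕ (pv e) (pv e zero) (inject₁ i) = pe-links e i

  pathV-internal : ∀ e {a} → 0 < a → a < ℓ e → ∃ λ (i : Fin (suc (ℓ e))) → Internal i × pathV e a ≡ pv e i
  pathV-internal e {a} 0<a a<ℓ =
    fromℕ< a<1+ℓ , subst (λ t → 0 < t × t < ℓ e) (sym (toℕ-fromℕ< a<1+ℓ)) (0<a , a<ℓ) , at-fromℕ< (pv e) _ a<1+ℓ
    where
    a<1+ℓ : a < suc (ℓ e)
    a<1+ℓ = m<n⇒m<1+n a<ℓ

  pathV-internal≢φ : ∀ e {a} x → 0 < a → a < ℓ e → pathV e a ≢ φ x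
  pathV-internal≢φ e x 0<a a<ℓ eq =
    let i , int , eqi = pathV-internal e 0<a a<ℓ in int-notφ e i x int (trans (sym eqi) eq)

  pathV-internal-owner : ∀ e f {a b} → 0 < a → a < ℓ e → b ≤ ℓ f → pathV e a ≡ pathV f b → e ≡ f
  pathV-internal-owner e f 0<a a<ℓ b≤ℓ eq =
    let i , int , eqi = pathV-internal e 0<a a<ℓ
    in int-disj e f i _ int (trans (sym eqi) (trans eq (at-fromℕ< (pv f) _ (s≤s b≤ℓ))))

  pathE-injective : ∀ {e e′ j j′} → j < ℓ e → j′ < ℓ e′ → pathE e j ≡ pathE e′ j′ → e ≡ e′ × j ≡ j′
  pathE-injective {e} {e′} {j} {j′} j<ℓ j′<ℓ eq
    with refl ← e-unique e e′ _ _ (trans (sym (at-fromℕ< (pe e) _ j<ℓ)) (trans eq (at-fromℕ< (pe e′) _ j′<ℓ)))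
    with Joins-unique H (pathE-joins e j<ℓ) (subst (λ h → Joins H h (pathV e j′) (pathV e (suc j′))) (sym eq) (pathE-joins e j′<ℓ))
  ... | inj₁ (same , _) = refl , pathV-injective e (<⇒≤ j<ℓ) (<⇒≤ j′<ℓ) same
  ... | inj₂ (j≡1+j′ , 1+j≡j′) =
    contradiction (trans (sym (cong suc (pathV-injective e (<⇒≤ j<ℓ) j′<ℓ j≡1+j′))) (pathV-injective e j<ℓ (<⇒≤ j′<ℓ) 1+j≡j′))
                  (>⇒≢ (m<n⇒m<1+n (n<1+n j′)))

  pathE-cover : ∀ h → ∃ λ e → ∃ λ j → j < ℓ e × pathE e j ≡ h
  pathE-cover h = let e , i , eq = e-cover h in e , toℕ i , toℕ<n i , trans (at-toℕ (pe e) _ i) eq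

  pathV-cover : ∀ v → (∃ λ x → φ x ≡ v) ⊎ (∃ λ e → ∃ λ a → a ≤ ℓ e × pathV e a ≡ v)
  pathV-cover v with v-cover v
  ... | inj₁ branch = inj₁ branch
  ... | inj₂ (e , i , eq) = inj₂ (e , toℕ i , ≤-pred (toℕ<n i) , trans (at-toℕ (pv e) _ i) eq)

  -- Every edge of H is pathE e j for a unique e and j < ℓ e, so g determines a function on Edge H.
  -- Opaque: unfolding the witness of pathE-cover makes conversion checks in its uses explode.
  opaque
    onPaths : ∀ {A : Set} → ((e : Edge G) → ℕ → A) → Edge H → A
    onPaths g h = g (proj₁ (pathE-cover h)) (proj₁ (proj₂ (pathE-cover h)))

    onPaths-pathE : ∀ {A : Set} (g : (e : Edge G) → ℕ → A) {e j} → j < ℓ e → onPaths g (pathE e j) ≡ g e j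
    onPaths-pathE g {e} {j} j<ℓ = any-cover (pathE-cover (pathE e j))
      where
      any-cover : (t : ∃ λ e′ → ∃ λ j′ → j′ < ℓ e′ × pathE e′ j′ ≡ pathE e j) → g (proj₁ t) (proj₁ (proj₂ t)) ≡ g e j
      any-cover (e′ , j′ , j′<ℓ , eq) with refl , refl ← pathE-injective j′<ℓ j<ℓ eq = refl

  travV : Edge G → Bool → ℕ → Vertex H
  travV e true  j = pathV e j
  travV e false j = pathV e (ℓ e ∸ j)

  travE : Edge G → Bool → ℕ → Edge H
  travE e true  j = pathE e j
  travE e false j = pathE e (ℓ e ∸ suc j)

  travV-start : ∀ e d → travV e d 0 ≡ φ (proj₁ (oriented G d e))
  travV-start e true  = pathV-start e
  travV-start e false = pathV-end e

  travV-end : ∀ e d → travV e d (ℓ e) ≡ φ (proj₂ (oriented G d e))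
  travV-end e true  = pathV-end e
  travV-end e false = trans (cong (pathV e) (n∸n≡0 (ℓ e))) (pathV-start e)

  travE-joins : ∀ e d {j} → j < ℓ e → Joins H (travE e d j) (travV e d j) (travV e d (suc j))
  travE-joins e true  j<ℓ = pathE-joins e j<ℓ
  travE-joins e false {j} j<ℓ =
    Joins-sym H (subst (Joins H (pathE e i) (pathV e i) ∘ pathV e) (suc-∸-suc j<ℓ) (pathE-joins e (∸-suc-< j<ℓ)))
    where i = ℓ e ∸ suc j

  travV-injective : ∀ e d {a b} → a ≤ ℓ e → b ≤ ℓ e → travV e d a ≡ travV e d b → a ≡ b
  travV-injective e true  a≤ℓ b≤ℓ eq = pathV-injective e a≤ℓ b≤ℓ eq
  travV-injective e false {a} {b} a≤ℓ b≤ℓ eq =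
    ∸-cancelˡ-≡ a≤ℓ b≤ℓ (pathV-injective e (m∸n≤m (ℓ e) a) (m∸n≤m (ℓ e) b) eq)

  travV-internal : ∀ e d {j} → 0 < j → j < ℓ e → ∃ λ a → 0 < a × a < ℓ e × travV e d j ≡ pathV e a
  travV-internal e true  {j} 0<j j<ℓ = j , 0<j , j<ℓ , refl
  travV-internal e false {j} 0<j j<ℓ =
    ℓ e ∸ j , subst (0 <_) (suc-∸-suc j<ℓ) z<s , ∸-monoʳ-< 0<j (<⇒≤ j<ℓ) , refl

  travE-pathE : ∀ e d {j} → j < ℓ e → ∃ λ a → a < ℓ e × travE e d j ≡ pathE e a
  travE-pathE e true  {j} j<ℓ = j , j<ℓ , refl
  travE-pathE e false {j} j<ℓ = ℓ e ∸ suc j , ∸-suc-< j<ℓ , refl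

  pathE-travE : ∀ e d {a} → a < ℓ e → ∃ λ j → j < ℓ e × travE e d j ≡ pathE e a
  pathE-travE e true  {a} a<ℓ = a , a<ℓ , refl
  pathE-travE e false {a} a<ℓ =
    ℓ e ∸ suc a , ∸-suc-< a<ℓ , cong (pathE e) (trans (cong (ℓ e ∸_) (suc-∸-suc a<ℓ)) (m∸[m∸n]≡n (<⇒≤ a<ℓ)))

module FactorLift {G H : Graph} (S : EvenSubdivision G H) (F : EdgeSet G) where
  open Paths S

  -- Both end positions 0 and 2 · half e are even, so the end edges of the path of e are in F′ iff e ∈ F.
  inF′ : Edge G → ℕ → Bool
  inF′ e j = if F e then evenᵇ j else not (evenᵇ j)

  F′ : EdgeSet H
  F′ = onPaths inF′

  F′-pathE : ∀ {e j} → j < ℓ e → F′ (pathE e j) ≡ inF′ e j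
  F′-pathE = onPaths-pathE inF′

  inF′-suc : ∀ e j → inF′ e (suc j) ≡ not (inF′ e j)
  inF′-suc e j with F e
  ... | true  = evenᵇ-suc j
  ... | false = cong not (evenᵇ-suc j)

  inF′-even⇒F : ∀ e j → inF′ e j ≡ true → evenᵇ j ≡ true → F e ≡ true
  inF′-even⇒F e j Fj ev with F e
  ... | true  = refl
  ... | false = contradiction (trans (sym (cong not ev)) Fj) λ ()

  inF′-alternates : ∀ e j → inF′ e j ≡ true → inF′ e (suc j) ≡ true → ⊥
  inF′-alternates e j Fj F1+j with () ← trans (sym (trans (inF′-suc e j) (cong not Fj))) F1+j

  count-parity : ∀ b h → countTo (pathLen h) (λ j → if b then evenᵇ j else not (evenᵇ j)) ≡ h + iverson b
  count-parity true  zero    = refl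
  count-parity false zero    = refl
  count-parity b     (suc h) rewrite +-suc h (h + 0) with b
  ... | true  = cong suc (count-parity true h)
  ... | false = cong suc (count-parity false h)

  count-F′-travE : ∀ e d → countTo (ℓ e) (F′ ∘ travE e d) ≡ half e + iverson (F e)
  count-F′-travE e true  = trans (sumTo-cong (ℓ e) (λ j j<ℓ → cong iverson (F′-pathE j<ℓ))) (count-parity (F e) (half e))
  count-F′-travE e false = begin
    countTo (ℓ e) (λ j → F′ (pathE e (ℓ e ∸ suc j)))         ≡⟨ sumTo-cong (ℓ e) (λ j j<ℓ → cong iverson (F′-pathE (∸-suc-< j<ℓ))) ⟩
    sumTo (ℓ e) (λ j → iverson (inF′ e (ℓ e ∸ suc j)))      ≡⟨ sumTo-reverse (ℓ e) (iverson ∘ inF′ e) ⟩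
    countTo (ℓ e) (inF′ e)                                    ≡⟨ count-parity (F e) (half e) ⟩
    half e + iverson (F e)                                    ∎
    where open ≡-Reasoning

  module _ (isF : IsOneFactor G F) where

    F′-at-branch : ∀ {e x} → F e ≡ true → Incident G e x → ∃ λ h → F′ h ≡ true × Incident H h (φ x)
    F′-at-branch {e} Fe (inj₁ refl) =
      pathE e 0 , trans (F′-pathE (0<ℓ e)) (cong (if_then true else false) Fe) ,
      subst (Incident H (pathE e 0)) (pathV-start e) (Joins⇒Incidentˡ H (pathE-joins e (0<ℓ e)))
    F′-at-branch {e} Fe (inj₂ refl) =
      pathE e (2 * half e) , trans (F′-pathE ≤-refl) (trans (cong (λ b → if b then _ else _) Fe) (evenᵇ-2* (half e))) ,
      subst (Incident H (pathE e (2 * half e))) (pathV-end e) (Joins⇒Incidentʳ H (pathE-joins e ≤-refl))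

    F′-at-internal : ∀ e {a} → 0 < a → a < ℓ e → ∃ λ h → F′ h ≡ true × Incident H h (pathV e a)
    F′-at-internal e {suc a} _ 1+a<ℓ with inF′ e (suc a) in F1+a
    ... | true  = pathE e (suc a) , trans (F′-pathE 1+a<ℓ) F1+a , Joins⇒Incidentˡ H (pathE-joins e 1+a<ℓ)
    ... | false = pathE e a , trans (F′-pathE (<⇒≤ 1+a<ℓ)) (not-injective (trans (sym (inF′-suc e a)) F1+a)) ,
                  Joins⇒Incidentʳ H (pathE-joins e (<⇒≤ 1+a<ℓ))

    F′-Covered : Vertex H → Set
    F′-Covered v = ∃ λ h → F′ h ≡ true × Incident H h v

    F′-covers-φ : ∀ x → F′-Covered (φ x)
    F′-covers-φ x = let e , Fe , i = IsOneFactor⇒∃ G isF x in F′-at-branch Fe i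

    F′-covers : ∀ v → F′-Covered v
    F′-covers v with pathV-cover v
    ... | inj₁ (x , refl) = F′-covers-φ x
    ... | inj₂ (e , a , a≤ℓ , refl) with position a≤ℓ
    ... | start refl    = subst F′-Covered (sym (pathV-start e)) (F′-covers-φ _)
    ... | end refl      = subst F′-Covered (sym (pathV-end e)) (F′-covers-φ _)
    ... | inner 0<a a<ℓ = F′-at-internal e 0<a a<ℓ

    data Meets (e : Edge G) (v : Vertex H) : Set where
      inside : ∀ {a} → 0 < a → a < ℓ e → pathV e a ≡ v → Meets e v
      branch : ∀ x → φ x ≡ v → F e ≡ true → Incident G e x → Meets e v

    meets : ∀ {e j v} → j < ℓ e → inF′ e j ≡ true → Incident H (pathE e j) v → Meets e v
    meets {e} {j} j<ℓ Fj i with Joins-Incident H (pathE-joins e j<ℓ) i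
    ... | inj₁ eq with position (<⇒≤ j<ℓ)
    ...   | start refl    = branch _ (trans (sym (pathV-start e)) eq) (inF′-even⇒F e 0 Fj refl) (inj₁ refl)
    ...   | end refl      = contradiction j<ℓ (<-irrefl refl)
    ...   | inner 0<j j<ℓ′ = inside 0<j j<ℓ′ eq
    meets {e} {j} {v} j<ℓ Fj i | inj₂ eq with position j<ℓ
    ...   | end 1+j≡ℓ     = branch _ (trans (sym (pathV-end e)) (subst (λ t → pathV e t ≡ v) 1+j≡ℓ eq))
                              (inF′-even⇒F e j Fj (subst (λ t → evenᵇ t ≡ true) (sym (suc-injective 1+j≡ℓ)) (evenᵇ-2* (half e))))
                              (inj₂ refl)
    ...   | inner _ 1+j<ℓ = inside z<s 1+j<ℓ eq

    Meets-same-edge : ∀ {e e′ v} → Meets e v → Meets e′ v → e ≡ e′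
    Meets-same-edge (inside 0<a a<ℓ eq) (inside _ a′<ℓ eq′) = pathV-internal-owner _ _ 0<a a<ℓ (<⇒≤ a′<ℓ) (trans eq (sym eq′))
    Meets-same-edge (inside 0<a a<ℓ eq) (branch x φx≡v _ _) = contradiction (trans eq (sym φx≡v)) (pathV-internal≢φ _ x 0<a a<ℓ)
    Meets-same-edge (branch x φx≡v _ _) (inside 0<a a<ℓ eq) = contradiction (trans eq (sym φx≡v)) (pathV-internal≢φ _ x 0<a a<ℓ)
    Meets-same-edge (branch x φx≡v Fe i) (branch x′ φx′≡v Fe′ i′) with refl ← φ-inj x x′ (trans φx≡v (sym φx′≡v)) =
      IsOneFactor⇒unique G isF Fe i Fe′ i′

    same-position : ∀ {e j j′ v} → j < ℓ e → j′ < ℓ e → inF′ e j ≡ true → inF′ e j′ ≡ true →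
                    Incident H (pathE e j) v → Incident H (pathE e j′) v → j ≡ j′
    same-position {e} {j} {j′} j<ℓ j′<ℓ Fj Fj′ i i′
      with Joins-Incident H (pathE-joins e j<ℓ) i | Joins-Incident H (pathE-joins e j′<ℓ) i′
    ... | inj₁ eq | inj₁ eq′ = pathV-injective e (<⇒≤ j<ℓ) (<⇒≤ j′<ℓ) (trans eq (sym eq′))
    ... | inj₂ eq | inj₂ eq′ = suc-injective (pathV-injective e j<ℓ j′<ℓ (trans eq (sym eq′)))
    ... | inj₁ eq | inj₂ eq′ with refl ← pathV-injective e (<⇒≤ j<ℓ) j′<ℓ (trans eq (sym eq′)) = ⊥-elim (inF′-alternates e j′ Fj′ Fj)
    ... | inj₂ eq | inj₁ eq′ with refl ← pathV-injective e j<ℓ (<⇒≤ j′<ℓ) (trans eq (sym eq′)) = ⊥-elim (inF′-alternates e j Fj Fj′)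

    F′-unique : ∀ {v h h′} → F′ h ≡ true → Incident H h v → F′ h′ ≡ true → Incident H h′ v → h ≡ h′
    F′-unique {h = h} {h′} Fh i Fh′ i′ with pathE-cover h | pathE-cover h′
    ... | e , j , j<ℓ , refl | e′ , j′ , j′<ℓ , refl = same (trans (sym (F′-pathE j<ℓ)) Fh) (trans (sym (F′-pathE j′<ℓ)) Fh′)
      where
      same : inF′ e j ≡ true → inF′ e′ j′ ≡ true → pathE e j ≡ pathE e′ j′
      same Fj Fj′ with refl ← Meets-same-edge (meets j<ℓ Fj i) (meets j′<ℓ Fj′ i′) =
        cong (pathE e) (same-position j<ℓ j′<ℓ Fj Fj′ i i′)

    F′-isOneFactor : IsOneFactor H F′
    F′-isOneFactor = ∃-unique⇒IsOneFactor H F′-covers F′-unique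

module OrientationLift {G H : Graph} (S : EvenSubdivision G H) (o : Orientation G) where
  open Paths S

  -- Each edge of the path of e is directed the way o directs e.
  tailAt : Edge G → ℕ → Vertex H
  tailAt e j = if o e then pathV e j else pathV e (suc j)

  startsAtTail : Edge G → ℕ → Bool
  startsAtTail e j = ⌊ proj₁ (ends H (pathE e j)) ≟ tailAt e j ⌋

  o′ : Orientation H
  o′ = onPaths startsAtTail

  tail-o′-pathE : ∀ {e j} → j < ℓ e → tail H o′ (pathE e j) ≡ tailAt e j
  tail-o′-pathE {e} {j} j<ℓ = tail-≟ H o′ (pathE e j) tailAt-incident (onPaths-pathE startsAtTail j<ℓ)
    where
    tailAt-incident : Incident H (pathE e j) (tailAt e j)
    tailAt-incident with o e
    ... | true  = Joins⇒Incidentˡ H (pathE-joins e j<ℓ)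
    ... | false = Joins⇒Incidentʳ H (pathE-joins e j<ℓ)

  forward-travE : ∀ e d {j} → j < ℓ e → ⌊ tail H o′ (travE e d j) ≟ travV e d j ⌋ ≡ (if d then o e else not (o e))
  forward-travE e true  j<ℓ rewrite tail-o′-pathE j<ℓ = if-≟-then (Joins⇒≢ H (pathE-joins e j<ℓ)) (o e)
  forward-travE e false {j} j<ℓ rewrite tail-o′-pathE (∸-suc-< j<ℓ) | sym (suc-∸-suc j<ℓ) =
    if-≟-else (Joins⇒≢ H (pathE-joins e (∸-suc-< j<ℓ))) (o e)

module CycleLift {G H : Graph} (S : EvenSubdivision G H) (C : Cycle G) where
  open Paths S
  open CycleAt C

  dir : ℕ → Bool
  dir i = ⌊ proj₁ (ends G (c i)) ≟ w i ⌋

  c-oriented : ∀ {i} → i < k → oriented G (dir i) (c i) ≡ (w i , w (suc i))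
  c-oriented i<k = Joins⇒oriented G (c-joins i<k)

  ℓc : ℕ → ℕ
  ℓc i = ℓ (c i)

  segV : ℕ → ℕ → Vertex H
  segV i = travV (c i) (dir i)

  segE : ℕ → ℕ → Edge H
  segE i = travE (c i) (dir i)

  segV-start : ∀ {i} → i < k → segV i 0 ≡ φ (w i)
  segV-start {i} i<k = trans (travV-start (c i) (dir i)) (cong (φ ∘ proj₁) (c-oriented i<k))

  segV-end : ∀ {i} → i < k → segV i (ℓc i) ≡ φ (w (suc i))
  segV-end {i} i<k = trans (travV-end (c i) (dir i)) (cong (φ ∘ proj₂) (c-oriented i<k))

  segV-injective : ∀ {i i′ j j′} → i < k → i′ < k → j < ℓc i → j′ < ℓc i′ → segV i j ≡ segV i′ j′ → i ≡ i′ × j ≡ j′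
  segV-injective {i} {i′} {zero} {zero} i<k i′<k _ _ eq =
    w-injective i<k i′<k (φ-inj _ _ (trans (sym (segV-start i<k)) (trans eq (segV-start i′<k)))) , refl
  segV-injective {i} {i′} {zero} {suc j′} i<k i′<k _ j′<ℓ eq =
    let a , 0<a , a<ℓ , eqa = travV-internal (c i′) (dir i′) z<s j′<ℓ
    in contradiction (trans (sym eqa) (trans (sym eq) (segV-start i<k))) (pathV-internal≢φ _ (w i) 0<a a<ℓ)
  segV-injective {i} {i′} {suc j} {zero} i<k i′<k j<ℓ _ eq =
    let a , 0<a , a<ℓ , eqa = travV-internal (c i) (dir i) z<s j<ℓ
    in contradiction (trans (sym eqa) (trans eq (segV-start i′<k))) (pathV-internal≢φ _ (w i′) 0<a a<ℓ)
  segV-injective {i} {i′} {suc j} {suc j′} i<k i′<k j<ℓ j′<ℓ eq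
    with travV-internal (c i) (dir i) z<s j<ℓ | travV-internal (c i′) (dir i′) z<s j′<ℓ
  ... | a , 0<a , a<ℓ , eqa | _ , _ , a′<ℓ , eqa′
    with refl ← c-injective i<k i′<k (pathV-internal-owner _ _ 0<a a<ℓ (<⇒≤ a′<ℓ) (trans (sym eqa) (trans eq eqa′)))
    = refl , travV-injective (c i) (dir i) (<⇒≤ j<ℓ) (<⇒≤ j′<ℓ) eq

  open Blocks ℓc

  L : ℕ
  L = offset k

  V : ℕ → Vertex H
  V = concat k segV

  E : ℕ → Edge H
  E = concat k segE

  V-offset : ∀ {i j} → i < k → j ≤ ℓc i → V (offset i + j) ≡ segV i j
  V-offset {i} {j} i<k j≤ℓ with m≤n⇒m<n∨m≡n j≤ℓ
  ... | inj₁ j<ℓ  = concat-offset+ segV i<k j<ℓ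
  ... | inj₂ refl = concat-offset-end segV (0<ℓ ∘ c) (λ 1+i<k → trans (segV-end (<⇒≤ 1+i<k)) (sym (segV-start 1+i<k))) i<k

  E-offset : ∀ {i j} → i < k → j < ℓc i → E (offset i + j) ≡ segE i j
  E-offset = concat-offset+ segE

  E-joins : ∀ {n} → n < L → Joins H (E n) (V n) (V (suc n))
  E-joins n<L with split k n<L
  ... | i , j , i<k , j<ℓ , refl rewrite E-offset i<k j<ℓ | V-offset i<k (<⇒≤ j<ℓ) | sym (+-suc (offset i) j)
                                       | V-offset i<k j<ℓ = travE-joins (c i) (dir i) j<ℓ

  V-injective : ∀ {n n′} → n < L → n′ < L → V n ≡ V n′ → n ≡ n′
  V-injective n<L n′<L eq with split k n<L | split k n′<L
  ... | i , j , i<k , j<ℓ , refl | i′ , j′ , i′<k , j′<ℓ , refl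
    with refl , refl ← segV-injective i<k i′<k j<ℓ j′<ℓ (trans (sym (V-offset i<k (<⇒≤ j<ℓ))) (trans eq (V-offset i′<k (<⇒≤ j′<ℓ))))
    = refl

  V-last : ∀ {k′} → suc k′ ≡ k → V (offset (suc k′)) ≡ φ (w 0)
  V-last {k′} 1+k′≡k = begin
    V (offset k′ + ℓc k′)  ≡⟨ V-offset k′<k ≤-refl ⟩
    segV k′ (ℓc k′)        ≡⟨ segV-end k′<k ⟩
    φ (w (suc k′))         ≡⟨ cong (φ ∘ w) 1+k′≡k ⟩
    φ (w k)                ≡⟨ cong φ w-k ⟩
    φ (w 0)                ∎
    where
    open ≡-Reasoning
    k′<k : k′ < k
    k′<k = subst (k′ <_) 1+k′≡k ≤-refl

  V-closed : V 0 ≡ V L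
  V-closed = begin
    V 0                       ≡⟨ V-offset 0<k z≤n ⟩
    segV 0 0                  ≡⟨ segV-start 0<k ⟩
    φ (w 0)                   ≡⟨ V-last k∸1+1 ⟨
    V (offset (suc (k ∸ 1)))  ≡⟨ cong (V ∘ offset) k∸1+1 ⟩
    V L                       ∎
    where
    open ≡-Reasoning
    k∸1+1 : suc (k ∸ 1) ≡ k
    k∸1+1 = m+[n∸m]≡n 0<k

  Σhalf : ℕ
  Σhalf = sumTo k (half ∘ c)

  L≡k+2Σhalf : L ≡ k + 2 * Σhalf
  L≡k+2Σhalf = begin
    offset k                                           ≡⟨ offset≡sumTo k ⟩
    sumTo k (λ i → 1 + 2 * half (c i))                 ≡⟨ sumTo-+ k (λ _ → 1) (λ i → 2 * half (c i)) ⟩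
    sumTo k (λ _ → 1) + sumTo k (λ i → 2 * half (c i)) ≡⟨ cong₂ _+_ (trans (sumTo-const k 1) (*-identityʳ k)) (sumTo-*ˡ k 2 (half ∘ c)) ⟩
    k + 2 * Σhalf                                      ∎
    where open ≡-Reasoning

  lift : Cycle H
  lift = record
    { len      = L
    ; len≥3    = ≤-trans (len≥3 C) (subst (k ≤_) (sym L≡k+2Σhalf) (m≤m+n k _))
    ; vtx      = V ∘ toℕ
    ; edg      = E ∘ toℕ
    ; closed   = trans V-closed (cong V (sym (toℕ-fromℕ L)))
    ; distinct = λ i j eq → toℕ-injective (V-injective (toℕ<n i) (toℕ<n j)
                   (trans (cong V (sym (toℕ-inject₁ i))) (trans eq (cong V (toℕ-inject₁ j)))))
    ; links    = λ i → subst (λ t → Joins H (E (toℕ i)) (V t) (V (suc (toℕ i)))) (sym (toℕ-inject₁ i)) (E-joins (toℕ<n i))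
    }

  countFin-lift : ∀ (p : Edge H → Vertex H → Bool) →
                  countFin L (λ x → p (edg lift x) (vtx lift (inject₁ x))) ≡ sumTo k (λ i → countTo (ℓc i) (λ j → p (segE i j) (segV i j)))
  countFin-lift p = begin
    countFin L (λ x → p (E (toℕ x)) (V (toℕ (inject₁ x))))  ≡⟨ countFin-cong L (λ x → cong (p (E (toℕ x)) ∘ V) (toℕ-inject₁ x)) ⟩
    countFin L (λ x → p (E (toℕ x)) (V (toℕ x)))            ≡⟨ countFin-toℕ L (λ n → p (E n) (V n)) ⟩
    countTo L (λ n → p (E n) (V n))                          ≡⟨ sumTo-offset k (λ n → iverson (p (E n) (V n))) ⟩
    sumTo k (λ i → countTo (ℓc i) (λ j → p (E (offset i + j)) (V (offset i + j))))
      ≡⟨ sumTo-cong k (λ i i<k → sumTo-cong (ℓc i) (λ j j<ℓ →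
           cong₂ (λ h v → iverson (p h v)) (E-offset i<k j<ℓ) (V-offset i<k (<⇒≤ j<ℓ)))) ⟩
    sumTo k (λ i → countTo (ℓc i) (λ j → p (segE i j) (segV i j))) ∎
    where open ≡-Reasoning

  module _ (F : EdgeSet G) where
    open FactorLift S F

    lift-FAlternating : FAlternating G F C → FAlternating H F′ lift
    lift-FAlternating alt = begin
      L                                   ≡⟨ L≡k+2Σhalf ⟩
      k + 2 * Σhalf                       ≡⟨ cong (_+ 2 * Σhalf) (trans alt (cong (2 *_) countF)) ⟩
      2 * countTo k (F ∘ c) + 2 * Σhalf   ≡⟨ *-distribˡ-+ 2 (countTo k (F ∘ c)) Σhalf ⟨
      2 * (countTo k (F ∘ c) + Σhalf)     ≡⟨ cong (2 *_) (trans (+-comm _ Σhalf) (sym countF′)) ⟩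
      2 * countFin L (F′ ∘ edg lift)      ∎
      where
      open ≡-Reasoning
      countF : countFin k (F ∘ edg C) ≡ countTo k (F ∘ c)
      countF = trans (countFin-cong k (λ x → cong F (sym (c-toℕ x)))) (countFin-toℕ k (F ∘ c))
      countF′ : countFin L (F′ ∘ edg lift) ≡ Σhalf + countTo k (F ∘ c)
      countF′ = trans (countFin-lift (λ h _ → F′ h))
                  (trans (sumTo-cong k (λ i i<k → count-F′-travE (c i) (dir i)))
                         (sumTo-+ k (half ∘ c) (iverson ∘ F ∘ c)))

  module _ (o : Orientation G) where
    open OrientationLift S o

    forward : ℕ → Bool
    forward i = ⌊ tail G o (c i) ≟ w i ⌋

    forward-segE : ∀ {i j} → i < k → j < ℓc i → ⌊ tail H o′ (segE i j) ≟ segV i j ⌋ ≡ forward i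
    forward-segE {i} {j} i<k j<ℓ = begin
      ⌊ tail H o′ (segE i j) ≟ segV i j ⌋              ≡⟨ forward-travE (c i) (dir i) j<ℓ ⟩
      (if dir i then o (c i) else not (o (c i)))       ≡⟨ tail-≟-oriented G o (c i) (dir i) ⟨
      ⌊ tail G o (c i) ≟ proj₁ (oriented G (dir i) (c i)) ⌋ ≡⟨ cong (λ t → ⌊ tail G o (c i) ≟ proj₁ t ⌋) (c-oriented i<k) ⟩
      forward i                                        ∎
      where open ≡-Reasoning

    -- Each edge of C becomes an odd number 2 · half + 1 of edges of the lift, all directed alike.
    forwardCount-lift : forwardCount H o′ lift ≡ countTo k forward + 2 * sumTo k (λ i → half (c i) * iverson (forward i))
    forwardCount-lift = begin
      forwardCount H o′ lift                                      ≡⟨ countFin-lift (λ h v → ⌊ tail H o′ h ≟ v ⌋) ⟩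
      sumTo k (λ i → countTo (ℓc i) (λ j → ⌊ tail H o′ (segE i j) ≟ segV i j ⌋))
        ≡⟨ sumTo-cong k (λ i i<k → trans (sumTo-cong (ℓc i) (λ j j<ℓ → cong iverson (forward-segE i<k j<ℓ)))
                                         (sumTo-const (ℓc i) (iverson (forward i)))) ⟩
      sumTo k (λ i → ℓc i * iverson (forward i))
        ≡⟨ sumTo-cong k (λ i _ → cong (iverson (forward i) +_) (*-assoc 2 (half (c i)) (iverson (forward i)))) ⟩
      sumTo k (λ i → iverson (forward i) + 2 * (half (c i) * iverson (forward i)))
        ≡⟨ sumTo-+ k (iverson ∘ forward) _ ⟩
      countTo k forward + sumTo k (λ i → 2 * (half (c i) * iverson (forward i)))
        ≡⟨ cong (countTo k forward +_) (sumTo-*ˡ k 2 (λ i → half (c i) * iverson (forward i))) ⟩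
      countTo k forward + 2 * sumTo k (λ i → half (c i) * iverson (forward i)) ∎
      where open ≡-Reasoning

    forwardCount-C : forwardCount G o C ≡ countTo k forward
    forwardCount-C = trans (countFin-cong k (λ x → cong₂ (λ h v → ⌊ tail G o h ≟ v ⌋) (sym (c-toℕ x)) (sym (w-toℕ x))))
                           (countFin-toℕ k forward)

    lift-evenlyOriented : EvenlyOriented G o C → EvenlyOriented H o′ lift
    lift-evenlyOriented (q , fwd≡2q) = q + extra , (begin
      forwardCount H o′ lift          ≡⟨ forwardCount-lift ⟩
      countTo k forward + 2 * extra   ≡⟨ cong (_+ 2 * extra) (trans (sym forwardCount-C) fwd≡2q) ⟩
      2 * q + 2 * extra               ≡⟨ *-distribˡ-+ 2 q extra ⟨
      2 * (q + extra)                 ∎)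
      where
      open ≡-Reasoning
      extra = sumTo k (λ i → half (c i) * iverson (forward i))

  pathE∈lift : ∀ {e j} → j < ℓ e → (pathE e j ∈Cᵇ lift) ≡ (e ∈Cᵇ C)
  pathE∈lift {e} {j} j<ℓ = ≡true⇔⇒≡ lift⇒C C⇒lift
    where
    lift⇒C : (pathE e j ∈Cᵇ lift) ≡ true → (e ∈Cᵇ C) ≡ true
    lift⇒C t with anyFin≡true⇒∃ L _ t
    ... | x , hit with split k (toℕ<n x)
    ... | i , j′ , i<k , j′<ℓ , n≡ with travE-pathE (c i) (dir i) j′<ℓ
    ... | a , a<ℓ , segE≡
      with refl , _ ← pathE-injective a<ℓ j<ℓ (trans (sym segE≡) (trans (sym (E-offset i<k j′<ℓ)) (trans (cong E (sym n≡)) (⌊≟⌋≡true⇒≡ hit))))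
      = ∃⇒anyFin≡true k _ (fromℕ< i<k) (≡⇒⌊≟⌋≡true (sym (at-fromℕ< (edg C) _ i<k)))
    C⇒lift : (e ∈Cᵇ C) ≡ true → (pathE e j ∈Cᵇ lift) ≡ true
    C⇒lift t with anyFin≡true⇒∃ k _ t
    ... | x , hit with refl ← trans (c-toℕ x) (⌊≟⌋≡true⇒≡ hit) with pathE-travE (c (toℕ x)) (dir (toℕ x)) j<ℓ
    ... | j′ , j′<ℓ , segE≡ = ∃⇒anyFin≡true L _ (fromℕ< n<L) (≡⇒⌊≟⌋≡true (begin
      E (toℕ (fromℕ< n<L))       ≡⟨ cong E (toℕ-fromℕ< n<L) ⟩
      E (offset (toℕ x) + j′)    ≡⟨ E-offset (toℕ<n x) j′<ℓ ⟩
      segE (toℕ x) j′            ≡⟨ segE≡ ⟩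
      pathE (c (toℕ x)) j        ∎))
      where
      open ≡-Reasoning
      n<L : offset (toℕ x) + j′ < L
      n<L = <-≤-trans (+-monoʳ-< (offset (toℕ x)) j′<ℓ) (offset-mono (toℕ<n x))

lemma3p5 : (G H : Graph) → EvenSubdivision G H → SimplyBad G → SimplyBad H
lemma3p5 G H S (F , isF , A , ((alternating , zeroSum) , oddLength) , o , evenlyOriented) =
  F′ , F′-isOneFactor isF ,
  map lift A , ((map⁺ (All.map (λ {C} → lift-FAlternating C F) alternating) , zeroSum′) ,
                 subst Odd (sym (length-map lift A)) oddLength) ,
  o′ , map⁺ (All.map (λ {C} → lift-evenlyOriented C o) evenlyOriented)
  where
  open Paths S
  open FactorLift S F
  open OrientationLift S o
  open CycleLift S using (lift; lift-FAlternating; lift-evenlyOriented; pathE∈lift)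

  count-lifts : ∀ {e j} → j < ℓ e → ∀ Cs → countList (pathE e j ∈Cᵇ_) (map lift Cs) ≡ countList (e ∈Cᵇ_) Cs
  count-lifts j<ℓ []       = refl
  count-lifts j<ℓ (C ∷ Cs) = cong₂ _+_ (cong iverson (pathE∈lift C j<ℓ)) (count-lifts j<ℓ Cs)

  zeroSum′ : ∀ h → Even (countList (h ∈Cᵇ_) (map lift A))
  zeroSum′ h with pathE-cover h
  ... | e , j , j<ℓ , refl = subst Even (sym (count-lifts j<ℓ A)) (zeroSum e)
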